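{- Let $\mathcal L$ be a finite, atomic, graded and coatomic lattice, let $\mathcal B$ be the family of bases of $\mathcal L$ and $\mathcal B^{opp}$ the family of bases of $\mathcal L^{opp}$. For $I\in\mathcal B$ put $I^{opp}=\{\bigvee(I\setminus\{a\}) : a\in I\}$. Then $I\mapsto I^{opp}$ is a well-defined bijection $\mathcal B\to\mathcal B^{opp}$.
   Context: Graded: $\mathcal L$ has least element $\hat0$, greatest element $\hat1$ and a rank function with $\mathrm{rank}(\hat0)=0$, order-preserving, increasing by exactly $1$ along covering relations. Atoms cover $\hat0$, coatoms are covered by $\hat1$; atomic (coatomic) means every element is a join of atoms (meet of coatoms). $\mathcal L^{opp}$ is the lattice on the same set with the reverse order; it is finite, graded (with rank $\mathrm{rank}(\hat1)-\mathrm{rank}(X)$) and atomic, its atoms being the coatoms of $\mathcal L$. For a finite bounded lattice $\mathcal K$ and a linear order $\omega$ on its atoms, a nonempty set $D$ of atoms is bounded below if some atom $a$ is strictly smaller than all $d\in D$ in $\omega$ and $a\le\bigvee D$ in $\mathcal K$; a set of atoms is NBB for $\omega$ if it contains no bounded below subset; $I(\mathcal K)$ is the family of sets of atoms NBB for at least one linear order. An element $I\in I(\mathcal K)$ is geometric if $\mathrm{rank}(\bigvee I)=|I|$; a basis of $\mathcal K$ is an inclusion-maximal member of $I(\mathcal K)$ all of whose subsets are geometric. -}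

module Defs where

open import Level using (0ℓ)
open import Data.Nat using (ℕ; zero; suc) renaming (_≤_ to _≤ℕ_)
open import Data.Fin using (Fin)
open import Data.Fin.Properties using (_≟_)
open import Data.Fin.Subset using (Subset; _∈_; _⊆_; _∪_; _─_; ⁅_⁆; ∣_∣; Nonempty)
open import Data.Vec using (Vec; allFin; foldr′; lookup)
open import Data.Bool using (if_then_else_)
open import Data.Product using (proj₁; Σ; Σ-syntax; ∃; ∃-syntax; _×_; _,_)
open import Relation.Nullary using (¬_)
open import Relation.Binary.Core using (Rel)
open import Relation.Binary.Structures using (IsStrictTotalOrder)
open import Relation.Binary.PropositionalEquality using (_≡_; _≢_)
open import Relation.Binary.Lattice.Structures using (IsBoundedLattice; IsLattice)
import Relation.Binary.Lattice.Bundles as LB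
import Relation.Binary.Lattice.Properties.Lattice as LP
open import Algebra.Core using (Op₂)

-- A finite bounded lattice: carrier Fin n (every finite lattice is
-- isomorphic to one of this form), equality is propositional equality.
record FinLattice : Set₁ where
  field
    n : ℕ
    _≤_ : Rel (Fin n) 0ℓ
    _∨_ : Op₂ (Fin n)
    _∧_ : Op₂ (Fin n)
    ⊤ : Fin n
    ⊥ : Fin n
    isBoundedLattice : IsBoundedLattice _≡_ _≤_ _∨_ _∧_ ⊤ ⊥

dual : FinLattice → FinLattice
dual L = record
  { n = n
  ; _≤_ = λ x y → y ≤ x
  ; _∨_ = _∧_
  ; _∧_ = _∨_
  ; ⊤ = ⊥
  ; ⊥ = ⊤
  ; isBoundedLattice = record
      { isLattice = LP.∧-∨-isLattice lat
      ; maximum = minimum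
      ; minimum = maximum
      }
  }
  where
    open FinLattice L
    open IsBoundedLattice isBoundedLattice using (isLattice; maximum; minimum)
    lat : LB.Lattice 0ℓ 0ℓ 0ℓ
    lat = record { isLattice = isLattice }

module _ (K : FinLattice) where
  open FinLattice K

  _<_ : Rel (Fin n) 0ℓ
  x < y = (x ≤ y) × (x ≢ y)

  _⋖_ : Rel (Fin n) 0ℓ
  x ⋖ y = (x < y) × (∀ z → x < z → ¬ (z < y))

  IsAtom : Fin n → Set
  IsAtom x = ⊥ ⋖ x

  IsCoatom : Fin n → Set
  IsCoatom x = x ⋖ ⊤

  ⋁ : Subset n → Fin n
  ⋁ S = foldr′ (λ x acc → if lookup S x then x ∨ acc else acc) ⊥ (allFin n)

  ⋀ : Subset n → Fin n
  ⋀ S = foldr′ (λ x acc → if lookup S x then x ∧ acc else acc) ⊤ (allFin n)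

  AtomSet : Subset n → Set
  AtomSet S = ∀ x → x ∈ S → IsAtom x

  IsRank : (Fin n → ℕ) → Set
  IsRank r = (r ⊥ ≡ 0)
           × (∀ x y → x ≤ y → r x ≤ℕ r y)
           × (∀ x y → x ⋖ y → r y ≡ suc (r x))

  Graded : Set
  Graded = Σ[ r ∈ (Fin n → ℕ) ] IsRank r

  Atomic : Set
  Atomic = ∀ x → Σ[ S ∈ Subset n ] (AtomSet S × (⋁ S ≡ x))

  Coatomic : Set
  Coatomic = ∀ x → Σ[ S ∈ Subset n ] ((∀ y → y ∈ S → IsCoatom y) × (⋀ S ≡ x))

  -- a linear order ω (strict total order on Fin n; only its restriction
  -- to the atoms matters)
  LinearOrder : Set₁
  LinearOrder = Σ (Rel (Fin n) 0ℓ) (λ ω → IsStrictTotalOrder _≡_ ω)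

  BoundedBelow : Rel (Fin n) 0ℓ → Subset n → Set
  BoundedBelow _<ω_ D =
    Nonempty D × AtomSet D ×
    (Σ[ a ∈ Fin n ] (IsAtom a × (∀ d → d ∈ D → a <ω d) × (a ≤ ⋁ D)))

  NBB : Rel (Fin n) 0ℓ → Subset n → Set
  NBB _<ω_ I = ∀ D → D ⊆ I → ¬ BoundedBelow _<ω_ D

  InI : Subset n → Set₁
  InI I = AtomSet I × (Σ[ ω ∈ LinearOrder ] NBB (proj₁ ω) I)

  -- geometric: rank (⋁ I) = |I|  (the rank function of a graded lattice
  -- is unique; we require it for every rank function)
  Geometric : Subset n → Set
  Geometric I = ∀ r → IsRank r → r (⋁ I) ≡ ∣ I ∣

  Basis : Subset n → Set₁
  Basis I = InI I
          × (∀ J → InI J → I ⊆ J → J ⊆ I)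
          × (∀ J → J ⊆ I → Geometric J)

  oppSet : Subset n → Subset n
  oppSet I = foldr′ (λ a acc → if lookup I a then ⁅ ⋁ (I ─ ⁅ a ⁆) ⁆ ∪ acc else acc)
                    Data.Fin.Subset.⊥ (allFin n)

-- A set of atoms is a basis exactly when it is independent (all its subsets are geometric)
-- and its join is ⊤. An independent set is NBB for the order listing a chosen atom first and
-- the set next; and if an NBB set contained a spanning independent set I and one more atom b,
-- then b ≤ ⋁ I, and exchanging ω-least elements of I against b yields a bounded-below subset.
-- For a basis I the elements H a = ⋁ (I ∖ {a}) are coatoms, and the meet of any k of them is
-- the join of the |I| − k atoms a whose H a is not among them. Counting ranks, I^opp is a
-- spanning independent set of atoms of L^opp, and removing H a from I^opp leaves the meet a,
-- so (I^opp)^opp = I. As L^opp is again atomic and graded, the map is a bijection.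

module Submission where

open import Defs
open import Level using (0ℓ)
open import Function using (_∘_; flip)
open import Data.Nat using (ℕ; suc; _+_; _∸_; s≤s) renaming (_≤_ to _≤ℕ_; _<_ to _<ℕ_)
import Data.Nat.Properties as ℕₚ
open import Data.Fin as Fin using (Fin)
import Data.Fin.Properties as Finₚ
open import Data.Fin.Induction using (spo-wellFounded; po-wellFounded; po-noetherian)
open import Data.Fin.Subset using (Subset; _∈_; _∉_; _⊆_; _⊂_; _∪_; _─_; _-_; ⁅_⁆; ∣_∣; Nonempty; inside; outside)
  renaming (⊥ to ∅)
import Data.Fin.Subset.Properties as Subsetₚ
open import Data.Fin.Subset.Induction using (⊂-wellFounded)
open import Data.Vec using (Vec; []; _∷_; allFin; foldr′; lookup; here; there)
import Data.Vec.Properties as Vecₚ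
import Data.Vec.Membership.Propositional as Vec∈
open import Data.Vec.Membership.Propositional.Properties using (∈-allFin⁺)
open import Data.Vec.Relation.Unary.Any using () renaming (here to here∈; there to there∈)
open import Data.Bool using (true; false; if_then_else_)
open import Data.Product using (proj₁; proj₂; Σ-syntax; _×_; _,_)
open import Data.Product.Relation.Binary.Lex.Strict using (×-Lex; ×-compare; ×-transitive; ×-irreflexive)
open import Data.Sum using (_⊎_; inj₁; inj₂; [_,_]′; map₂)
import Data.Empty as Empty
open import Relation.Nullary using (¬_; Dec; yes; no; does; contradiction; ¬?)
open import Relation.Nullary.Decidable using (map′; _×-dec_; decidable-stable)
open import Relation.Binary.Core using (Rel)
open import Relation.Binary.Definitions using (Decidable; Trichotomous; tri<; tri≈; tri>)
open import Relation.Binary.Consequences using (tri⇒irr)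
open import Relation.Binary.Structures using (IsStrictTotalOrder)
open import Relation.Binary.Lattice.Structures using (IsBoundedLattice)
open import Relation.Binary.PropositionalEquality
  using (_≡_; _≢_; refl; sym; trans; cong; subst; resp₂; isEquivalence; module ≡-Reasoning)
open import Induction.WellFounded using (WellFounded; Acc; acc)

private
  variable
    m : ℕ

x∈p─q⇒x∉q : ∀ (p q : Subset m) {x} → x ∈ p ─ q → x ∉ q
x∈p─q⇒x∉q (_ ∷ p)      (inside ∷ q)  ()        here
x∈p─q⇒x∉q (inside ∷ p) (outside ∷ q) here      ()
x∈p─q⇒x∉q (_ ∷ p)      (_ ∷ q)       (there h) (there h') = x∈p─q⇒x∉q p q h h'

x∈p-y⇒x≢y : ∀ {p : Subset m} {x y} → x ∈ p - y → x ≢ y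
x∈p-y⇒x≢y {p = p} {y = y} x∈p-y refl = x∈p─q⇒x∉q p ⁅ y ⁆ x∈p-y (Subsetₚ.x∈⁅x⁆ y)

p-y⊆p : ∀ (p : Subset m) y → p - y ⊆ p
p-y⊆p p y = Subsetₚ.p─q⊆p p ⁅ y ⁆

p⊆q⇒p-y⊆q-y : ∀ {p q : Subset m} {y} → p ⊆ q → p - y ⊆ q - y
p⊆q⇒p-y⊆q-y {p = p} {y = y} p⊆q x∈ = Subsetₚ.x∈p∧x≢y⇒x∈p-y (p⊆q (p-y⊆p p y x∈)) (x∈p-y⇒x≢y x∈)

∣p∣≡1+∣p-x∣ : ∀ (p : Subset m) {x} → x ∈ p → ∣ p ∣ ≡ suc ∣ p - x ∣
∣p∣≡1+∣p-x∣ (inside ∷ p)  here      = cong suc (cong ∣_∣ (sym (Subsetₚ.p─⊥≡p p)))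
∣p∣≡1+∣p-x∣ (inside ∷ p)  (there h) = cong suc (∣p∣≡1+∣p-x∣ p h)
∣p∣≡1+∣p-x∣ (outside ∷ p) (there h) = ∣p∣≡1+∣p-x∣ p h

∣p∣≡0 : ∀ {p : Subset m} → ¬ Nonempty p → ∣ p ∣ ≡ 0
∣p∣≡0 {m} p≡∅ = trans (cong ∣_∣ (Subsetₚ.Empty-unique p≡∅)) (Subsetₚ.∣⊥∣≡0 m)

x∈p∪⁅y⁆⁻ : ∀ (p : Subset m) {x y} → x ∈ p ∪ ⁅ y ⁆ → x ∈ p ⊎ x ≡ y
x∈p∪⁅y⁆⁻ p {y = y} x∈ = map₂ (Subsetₚ.x∈⁅y⁆⇒x≡y y) (Subsetₚ.x∈p∪q⁻ p ⁅ y ⁆ x∈)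

y∈p∪⁅y⁆ : ∀ (p : Subset m) y → y ∈ p ∪ ⁅ y ⁆
y∈p∪⁅y⁆ p y = Subsetₚ.x∈p∪q⁺ (inj₂ (Subsetₚ.x∈⁅x⁆ y))

p∪⁅y⁆⊆q : ∀ {p q : Subset m} {y} → p ⊆ q → y ∈ q → p ∪ ⁅ y ⁆ ⊆ q
p∪⁅y⁆⊆q {p = p} p⊆q y∈q x∈ with x∈p∪⁅y⁆⁻ p x∈
... | inj₁ x∈p = p⊆q x∈p
... | inj₂ refl = y∈q

module KeyOrder (key : Fin m → ℕ) where

  _≺_ : Rel (Fin m) 0ℓ
  x ≺ y = ×-Lex _≡_ _<ℕ_ Fin._<_ (key x , x) (key y , y)

  ≺⇒key≤ : ∀ {x y} → x ≺ y → key x ≤ℕ key y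
  ≺⇒key≤ = [ ℕₚ.<⇒≤ , ℕₚ.≤-reflexive ∘ proj₁ ]′

  ≺-compare : Trichotomous _≡_ _≺_
  ≺-compare x y with ×-compare sym ℕₚ.<-cmp Finₚ.<-cmp (key x , x) (key y , y)
  ... | tri< x≺y x≉y x⊁y        = tri< x≺y (λ { refl → x≉y (refl , refl) }) x⊁y
  ... | tri≈ x⊀y (_ , x≡y) x⊁y = tri≈ x⊀y x≡y x⊁y
  ... | tri> x⊀y x≉y y≺x        = tri> x⊀y (λ { refl → x≉y (refl , refl) }) y≺x

  isStrictTotalOrder : IsStrictTotalOrder _≡_ _≺_
  isStrictTotalOrder = record
    { isStrictPartialOrder = record
      { isEquivalence = isEquivalence
      ; irrefl = tri⇒irr ≺-compare
      ; trans = ×-transitive {_<₂_ = Fin._<_} isEquivalence ℕₚ.<-resp₂-≡ ℕₚ.<-trans Finₚ.<-trans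
      ; <-resp-≈ = resp₂ _≺_
      }
    ; compare = ≺-compare
    }

module ExtensionOrder (I : Subset m) (b : Fin m) where

  key : Fin m → ℕ
  key x = if does (x Finₚ.≟ b) then 0 else suc (if does (x Subsetₚ.∈? I) then 0 else 1)

  open KeyOrder key public using (_≺_; isStrictTotalOrder)
  open KeyOrder key using (≺⇒key≤)
  private module ≺ = IsStrictTotalOrder isStrictTotalOrder

  private
    key≤0⇒≡b : ∀ {x} → key x ≤ℕ 0 → x ≡ b
    key≤0⇒≡b {x} with x Finₚ.≟ b
    ... | yes x≡b = λ _ → x≡b
    ... | no _    = λ ()

    key≤1⇒∈I⊎≡b : ∀ {x} → key x ≤ℕ 1 → x ∈ I ⊎ x ≡ b
    key≤1⇒∈I⊎≡b {x} with x Finₚ.≟ b | x Subsetₚ.∈? I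
    ... | yes x≡b | _       = λ _ → inj₂ x≡b
    ... | no _    | yes x∈I = λ _ → inj₁ x∈I
    ... | no _    | no _    = λ { (s≤s ()) }

    key-b : key b ≡ 0
    key-b with b Finₚ.≟ b
    ... | yes _   = refl
    ... | no b≢b = contradiction refl b≢b

    key-I : ∀ {d} → d ∈ I → d ≢ b → key d ≡ 1
    key-I {d} d∈I d≢b with d Finₚ.≟ b | d Subsetₚ.∈? I
    ... | yes d≡b | _       = contradiction d≡b d≢b
    ... | no _    | yes _   = refl
    ... | no _    | no d∉I = contradiction d∈I d∉I

  ⊀b : ∀ {x} → ¬ x ≺ b
  ⊀b {x} x≺b = ≺.irrefl (key≤0⇒≡b (subst (key x ≤ℕ_) key-b (≺⇒key≤ x≺b))) x≺b

  ≺I⇒∈I⊎≡b : ∀ {x d} → x ≺ d → d ∈ I → d ≢ b → x ∈ I ⊎ x ≡ b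
  ≺I⇒∈I⊎≡b {x} x≺d d∈I d≢b = key≤1⇒∈I⊎≡b (subst (key x ≤ℕ_) (key-I d∈I d≢b) (≺⇒key≤ x≺d))

module _ {_≺_ : Rel (Fin m) 0ℓ} (sto : IsStrictTotalOrder _≡_ _≺_) where
  private module ≺ = IsStrictTotalOrder sto

  least : ∀ (T : Subset m) → Nonempty T →
          Σ[ t₀ ∈ Fin m ] (t₀ ∈ T × (∀ {t} → t ∈ T → t ≢ t₀ → t₀ ≺ t))
  least T (x , x∈T) = go x (spo-wellFounded ≺.isStrictPartialOrder x) x∈T
    where
    go : ∀ x → Acc _≺_ x → x ∈ T → Σ[ t₀ ∈ Fin m ] (t₀ ∈ T × (∀ {t} → t ∈ T → t ≢ t₀ → t₀ ≺ t))
    go x (acc smaller) x∈T with Finₚ.any? (λ t → (t Subsetₚ.∈? T) ×-dec (t ≺.<? x))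
    ... | yes (t , t∈T , t≺x) = go t (smaller t≺x) t∈T
    ... | no nothing-below = x , x∈T , above
      where
      above : ∀ {t} → t ∈ T → t ≢ x → x ≺ t
      above {t} t∈T t≢x with ≺.compare x t
      ... | tri< x≺t _ _ = x≺t
      ... | tri≈ _ x≡t _ = contradiction (sym x≡t) t≢x
      ... | tri> _ _ t≺x = contradiction (t , t∈T , t≺x) nothing-below

module Order (L : FinLattice) where
  open FinLattice L
  open IsBoundedLattice isBoundedLattice public
    using (isPartialOrder; x≤x∨y; y≤x∨y; ∨-least; x∧y≤x; x∧y≤y; ∧-greatest; minimum; maximum)
    renaming (refl to ≤-refl; trans to ≤-trans; antisym to ≤-antisym; reflexive to ≤-reflexive)

  _≤?_ : Decidable _≤_
  x ≤? y = map′ (λ x∨y≡y → subst (x ≤_) x∨y≡y (x≤x∨y x y))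
                (λ x≤y → ≤-antisym (∨-least x≤y ≤-refl) (y≤x∨y x y))
                ((x ∨ y) Finₚ.≟ y)

  _<?_ : Decidable (_<_ L)
  x <? y = (x ≤? y) ×-dec ¬? (x Finₚ.≟ y)

  <-wellFounded : WellFounded (_<_ L)
  <-wellFounded = po-wellFounded isPartialOrder

  <⇒⋖≤ : ∀ {x y} → _<_ L x y → Σ[ c ∈ Fin n ] (_⋖_ L x c × c ≤ y)
  <⇒⋖≤ {x} {y} x<y = go y (<-wellFounded y) x<y
    where
    go : ∀ y → Acc (_<_ L) y → _<_ L x y → Σ[ c ∈ Fin n ] (_⋖_ L x c × c ≤ y)
    go y (acc smaller) x<y with Finₚ.any? (λ z → (x <? z) ×-dec (z <? y))
    ... | yes (z , x<z , z<y) =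
      let c , x⋖c , c≤z = go z (smaller z<y) x<z in c , x⋖c , ≤-trans c≤z (proj₁ z<y)
    ... | no nothing-between = y , (x<y , λ z x<z z<y → nothing-between (z , x<z , z<y)) , ≤-refl

  ⋖-squeeze : ∀ {x y z} → _⋖_ L x y → x ≤ z → z ≤ y → z ≡ x ⊎ z ≡ y
  ⋖-squeeze {x} {y} {z} (_ , nothing-between) x≤z z≤y with z Finₚ.≟ x | z Finₚ.≟ y
  ... | yes z≡x | _     = inj₁ z≡x
  ... | no _    | yes z≡y = inj₂ z≡y
  ... | no z≢x  | no z≢y  = contradiction (z≤y , z≢y) (nothing-between z (x≤z , z≢x ∘ sym))

  ⋖-dual : ∀ {x y} → _⋖_ L x y → _⋖_ (dual L) y x
  ⋖-dual ((x≤y , x≢y) , nothing-between) =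
    (x≤y , x≢y ∘ sym) , λ z y>z z>x → nothing-between z (proj₁ z>x , proj₂ z>x ∘ sym) (proj₁ y>z , proj₂ y>z ∘ sym)

  private
    ⋁-over : Subset n → ∀ {k} → Vec (Fin n) k → Fin n
    ⋁-over S = foldr′ (λ x acc → if lookup S x then x ∨ acc else acc) ⊥

    x≤⋁-over : ∀ S {k} (xs : Vec (Fin n) k) {x} → x ∈ S → x Vec∈.∈ xs → x ≤ ⋁-over S xs
    x≤⋁-over S (y ∷ xs) x∈S (here∈ refl) rewrite Vecₚ.[]=⇒lookup x∈S = x≤x∨y _ _
    x≤⋁-over S (y ∷ xs) x∈S (there∈ x∈xs) with lookup S y
    ... | true  = ≤-trans (x≤⋁-over S xs x∈S x∈xs) (y≤x∨y _ _)
    ... | false = x≤⋁-over S xs x∈S x∈xs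

    ⋁-over-least : ∀ S {k} (xs : Vec (Fin n) k) {z} → (∀ {x} → x ∈ S → x ≤ z) → ⋁-over S xs ≤ z
    ⋁-over-least S []       S≤z = minimum _
    ⋁-over-least S (y ∷ xs) S≤z with lookup S y in eq
    ... | true  = ∨-least (S≤z (Vecₚ.lookup⇒[]= y S eq)) (⋁-over-least S xs S≤z)
    ... | false = ⋁-over-least S xs S≤z

  x≤⋁ : ∀ S {x} → x ∈ S → x ≤ ⋁ L S
  x≤⋁ S x∈S = x≤⋁-over S (allFin n) x∈S (∈-allFin⁺ _)

  ⋁-least : ∀ S {z} → (∀ {x} → x ∈ S → x ≤ z) → ⋁ L S ≤ z
  ⋁-least S = ⋁-over-least S (allFin n)

  ⋁-mono : ∀ {S T} → S ⊆ T → ⋁ L S ≤ ⋁ L T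
  ⋁-mono {S} {T} S⊆T = ⋁-least S (x≤⋁ T ∘ S⊆T)

  ⋁∅≡⊥ : ∀ {S} → ¬ Nonempty S → ⋁ L S ≡ ⊥
  ⋁∅≡⊥ {S} S≡∅ = ≤-antisym (⋁-least S (λ {x} x∈S → contradiction (x , x∈S) S≡∅)) (minimum _)

  ⋁-remove : ∀ S {h} → h ∈ S → ⋁ L S ≡ (h ∨ ⋁ L (S - h))
  ⋁-remove S {h} h∈S = ≤-antisym (⋁-least S ≤h∨⋁) (∨-least (x≤⋁ S h∈S) (⋁-mono (p-y⊆p S h)))
    where
    ≤h∨⋁ : ∀ {x} → x ∈ S → x ≤ (h ∨ ⋁ L (S - h))
    ≤h∨⋁ {x} x∈S with x Finₚ.≟ h
    ... | yes refl = x≤x∨y _ _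
    ... | no x≢h  = ≤-trans (x≤⋁ (S - h) (Subsetₚ.x∈p∧x≢y⇒x∈p-y x∈S x≢h)) (y≤x∨y _ _)

  NBB-⊆ : ∀ {_≺_ J K} → K ⊆ J → NBB L _≺_ J → NBB L _≺_ K
  NBB-⊆ K⊆J nbbJ D D⊆K = nbbJ D (K⊆J ∘ D⊆K)

  AtomSet-∪⁅⁆ : ∀ {S b} → AtomSet L S → IsAtom L b → AtomSet L (S ∪ ⁅ b ⁆)
  AtomSet-∪⁅⁆ {S} atS atb x x∈ = [ atS x , (λ { refl → atb }) ]′ (x∈p∪⁅y⁆⁻ S x∈)

  extensionOrder : Subset n → Fin n → LinearOrder L
  extensionOrder I b = ExtensionOrder._≺_ I b , ExtensionOrder.isStrictTotalOrder I b

  Independent : Subset n → Set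
  Independent I = ∀ J → J ⊆ I → Geometric L J

  private
    oppSet-over : Subset n → ∀ {k} → Vec (Fin n) k → Subset n
    oppSet-over I = foldr′ (λ a acc → if lookup I a then ⁅ ⋁ L (I ─ ⁅ a ⁆) ⁆ ∪ acc else acc) ∅

    ∈oppSet-over⁻ : ∀ I {k} (xs : Vec (Fin n) k) {y} → y ∈ oppSet-over I xs →
                    Σ[ a ∈ Fin n ] (a ∈ I × y ≡ ⋁ L (I - a))
    ∈oppSet-over⁻ I []       y∈ = contradiction y∈ Subsetₚ.∉⊥
    ∈oppSet-over⁻ I (x ∷ xs) y∈ with lookup I x in eq
    ... | false = ∈oppSet-over⁻ I xs y∈
    ... | true with Subsetₚ.x∈p∪q⁻ ⁅ ⋁ L (I - x) ⁆ (oppSet-over I xs) y∈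
    ...   | inj₁ y∈⁅⋁⁆ = x , Vecₚ.lookup⇒[]= x I eq , Subsetₚ.x∈⁅y⁆⇒x≡y _ y∈⁅⋁⁆
    ...   | inj₂ y∈rest = ∈oppSet-over⁻ I xs y∈rest

    ∈oppSet-over⁺ : ∀ I {k} (xs : Vec (Fin n) k) {a} → a ∈ I → a Vec∈.∈ xs → ⋁ L (I - a) ∈ oppSet-over I xs
    ∈oppSet-over⁺ I (x ∷ xs) a∈I (here∈ refl) rewrite Vecₚ.[]=⇒lookup a∈I =
      Subsetₚ.x∈p∪q⁺ (inj₁ (Subsetₚ.x∈⁅x⁆ _))
    ∈oppSet-over⁺ I (x ∷ xs) a∈I (there∈ a∈xs) with lookup I x
    ... | true  = Subsetₚ.x∈p∪q⁺ (inj₂ (∈oppSet-over⁺ I xs a∈I a∈xs))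
    ... | false = ∈oppSet-over⁺ I xs a∈I a∈xs

  ∈oppSet⁻ : ∀ {I y} → y ∈ oppSet L I → Σ[ a ∈ Fin n ] (a ∈ I × y ≡ ⋁ L (I - a))
  ∈oppSet⁻ {I} = ∈oppSet-over⁻ I (allFin n)

  ∈oppSet⁺ : ∀ {I a} → a ∈ I → ⋁ L (I - a) ∈ oppSet L I
  ∈oppSet⁺ {I} a∈I = ∈oppSet-over⁺ I (allFin n) a∈I (∈-allFin⁺ _)

module Rank (L : FinLattice) {r : Fin (FinLattice.n L) → ℕ} (isRank : IsRank L r) where
  open FinLattice L
  open Order L

  rank-mono : ∀ {x y} → x ≤ y → r x ≤ℕ r y
  rank-mono = proj₁ (proj₂ isRank) _ _

  rank-⋖ : ∀ {x y} → _⋖_ L x y → r y ≡ suc (r x)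
  rank-⋖ = proj₂ (proj₂ isRank) _ _

  rank-strict : ∀ {x y} → _<_ L x y → r x <ℕ r y
  rank-strict x<y = let c , x⋖c , c≤y = <⇒⋖≤ x<y in subst (_≤ℕ r _) (rank-⋖ x⋖c) (rank-mono c≤y)

  rank-suc⇒⋖ : ∀ {x y} → x ≤ y → r y ≡ suc (r x) → _⋖_ L x y
  rank-suc⇒⋖ {x} {y} x≤y ry≡1+rx = (x≤y , λ { refl → ℕₚ.1+n≢n (sym ry≡1+rx) }) , nothing-between
    where
    nothing-between : ∀ z → _<_ L x z → ¬ _<_ L z y
    nothing-between z x<z z<y =
      ℕₚ.<⇒≱ (rank-strict x<z) (ℕₚ.≤-pred (subst (suc (r z) ≤ℕ_) ry≡1+rx (rank-strict z<y)))

  rank-dual-sum : ∀ {r′} → IsRank (dual L) r′ → ∀ x → r′ x + r x ≡ r ⊤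
  rank-dual-sum {r′} isRank′ x = go x (po-noetherian isPartialOrder x)
    where
    open ≡-Reasoning
    go : ∀ x → Acc (flip (_<_ L)) x → r′ x + r x ≡ r ⊤
    go x (acc above) with x Finₚ.≟ ⊤
    ... | yes refl = cong (_+ r ⊤) (proj₁ isRank′)
    ... | no x≢⊤ = let c , x⋖c , _ = <⇒⋖≤ (maximum x , x≢⊤) in begin
      r′ x + r x        ≡⟨ cong (_+ r x) (proj₂ (proj₂ isRank′) c x (⋖-dual x⋖c)) ⟩
      suc (r′ c) + r x  ≡⟨ sym (ℕₚ.+-suc (r′ c) (r x)) ⟩
      r′ c + suc (r x)  ≡⟨ cong (r′ c +_) (sym (rank-⋖ x⋖c)) ⟩
      r′ c + r c        ≡⟨ go c (above (proj₁ x⋖c)) ⟩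
      r ⊤               ∎

  module _ {I : Subset n} (indI : Independent I) where

    rank-⋁ : ∀ {J} → J ⊆ I → r (⋁ L J) ≡ ∣ J ∣
    rank-⋁ {J} J⊆I = indI J J⊆I r isRank

    ⋁-remove-⋖ : ∀ {J c} → J ⊆ I → c ∈ J → _⋖_ L (⋁ L (J - c)) (⋁ L J)
    ⋁-remove-⋖ {J} {c} J⊆I c∈J = rank-suc⇒⋖ (⋁-mono (p-y⊆p J c)) (begin
      r (⋁ L J)               ≡⟨ rank-⋁ J⊆I ⟩
      ∣ J ∣                   ≡⟨ ∣p∣≡1+∣p-x∣ J c∈J ⟩
      suc ∣ J - c ∣           ≡⟨ cong suc (sym (rank-⋁ (J⊆I ∘ p-y⊆p J c))) ⟩
      suc (r (⋁ L (J - c)))   ∎)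
      where open ≡-Reasoning

    ≰⋁-remove : ∀ {J c} → J ⊆ I → c ∈ J → ¬ c ≤ ⋁ L (J - c)
    ≰⋁-remove {J} {c} J⊆I c∈J c≤⋁ = proj₂ (proj₁ (⋁-remove-⋖ J⊆I c∈J))
      (≤-antisym (⋁-mono (p-y⊆p J c))
                 (subst (_≤ ⋁ L (J - c)) (sym (⋁-remove J c∈J)) (∨-least c≤⋁ ≤-refl)))

    ≰⋁ : ∀ {D a} → D ⊆ I → a ∈ I → a ∉ D → ¬ a ≤ ⋁ L D
    ≰⋁ {D} {a} D⊆I a∈I a∉D a≤⋁D =
      ≰⋁-remove (p∪⁅y⁆⊆q D⊆I a∈I) (y∈p∪⁅y⁆ D a) (≤-trans a≤⋁D (⋁-mono D⊆D∪a-a))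
      where
      D⊆D∪a-a : D ⊆ (D ∪ ⁅ a ⁆) - a
      D⊆D∪a-a x∈D = Subsetₚ.x∈p∧x≢y⇒x∈p-y (Subsetₚ.p⊆p∪q _ x∈D) (λ { refl → a∉D x∈D })

    exchange : ∀ {T t b} → T ⊆ I → t ∈ T → b ≤ ⋁ L T → ¬ b ≤ ⋁ L (T - t) →
               t ≤ ⋁ L ((T - t) ∪ ⁅ b ⁆)
    exchange {T} {t} {b} T⊆I t∈T b≤⋁T b≰⋁T-t =
      [ (λ ⋁D≡⋁T-t → contradiction (subst (b ≤_) ⋁D≡⋁T-t (x≤⋁ D (y∈p∪⁅y⁆ (T - t) b))) b≰⋁T-t)
      , (λ ⋁D≡⋁T → subst (t ≤_) (sym ⋁D≡⋁T) (x≤⋁ T t∈T))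
      ]′ (⋖-squeeze (⋁-remove-⋖ T⊆I t∈T) (⋁-mono (Subsetₚ.p⊆p∪q {p = T - t} ⁅ b ⁆)) (⋁-least D D≤⋁T))
      where
      D : Subset n
      D = (T - t) ∪ ⁅ b ⁆

      D≤⋁T : ∀ {x} → x ∈ D → x ≤ ⋁ L T
      D≤⋁T x∈D = [ x≤⋁ T ∘ p-y⊆p T t , (λ { refl → b≤⋁T }) ]′ (x∈p∪⁅y⁆⁻ (T - t) x∈D)

    extension-NBB : ∀ {b} → b ∈ I ⊎ ¬ b ≤ ⋁ L I → NBB L (proj₁ (extensionOrder I b)) (I ∪ ⁅ b ⁆)
    extension-NBB {b} b∈I⊎b≰⋁I D D⊆I∪b ((d , d∈D) , _ , a , _ , a≺D , a≤⋁D) = by-cases (b Subsetₚ.∈? D)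
      where
      open ExtensionOrder I b
      open IsStrictTotalOrder isStrictTotalOrder using (irrefl)

      a∉D : a ∉ D
      a∉D a∈D = irrefl refl (a≺D a a∈D)

      by-cases : Dec (b ∈ D) → Empty.⊥
      by-cases (yes b∈D) = ⊀b (a≺D b b∈D)
      by-cases (no b∉D)  = a-cases (a Subsetₚ.∈? I) (a Finₚ.≟ b)
        where
        D⊆I : D ⊆ I
        D⊆I x∈D = [ (λ x∈I → x∈I) , (λ { refl → contradiction x∈D b∉D }) ]′ (x∈p∪⁅y⁆⁻ I (D⊆I∪b x∈D))

        a-cases : Dec (a ∈ I) → Dec (a ≡ b) → Empty.⊥
        a-cases (yes a∈I) _        = ≰⋁ D⊆I a∈I a∉D a≤⋁D
        a-cases (no _)    (yes refl) =
          [ (λ b∈I → ≰⋁ D⊆I b∈I a∉D a≤⋁D) , (λ b≰⋁I → b≰⋁I (≤-trans a≤⋁D (⋁-mono D⊆I))) ]′ b∈I⊎b≰⋁I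
        a-cases (no a∉I)  (no a≢b) =
          [ a∉I , a≢b ]′ (≺I⇒∈I⊎≡b (a≺D d d∈D) (D⊆I d∈D) (λ { refl → b∉D d∈D }))

    independent⇒InI : AtomSet L I → InI L I
    independent⇒InI atI with Subsetₚ.nonempty? I
    ... | yes (b , b∈I) = atI , extensionOrder I b , NBB-⊆ (Subsetₚ.p⊆p∪q ⁅ b ⁆) (extension-NBB (inj₁ b∈I))
    ... | no I≡∅ = atI , (Fin._<_ , Finₚ.<-isStrictTotalOrder) , λ D D⊆I ((d , d∈D) , _) → I≡∅ (d , D⊆I d∈D)

    dependent-extension-¬NBB : AtomSet L I → ∀ {b} → IsAtom L b → (ω : LinearOrder L) →
                              ∀ T → T ⊆ I → b ∉ T → b ≤ ⋁ L T → ¬ NBB L (proj₁ ω) (T ∪ ⁅ b ⁆)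
    dependent-extension-¬NBB atI {b} atb (_≺_ , sto) T = go T (⊂-wellFounded T)
      where
      module ≺ = IsStrictTotalOrder sto

      T-t∪b⊆T∪b : ∀ T t → (T - t) ∪ ⁅ b ⁆ ⊆ T ∪ ⁅ b ⁆
      T-t∪b⊆T∪b T t = p∪⁅y⁆⊆q (Subsetₚ.p⊆p∪q ⁅ b ⁆ ∘ p-y⊆p T t) (y∈p∪⁅y⁆ T b)

      -- With t the ω-least element of T: if b ≺ t then b bounds T below; otherwise either
      -- b ≤ ⋁ (T - t) and we recurse, or t bounds (T - t) ∪ ⁅ b ⁆ below by exchange.
      go : ∀ T → Acc _⊂_ T → T ⊆ I → b ∉ T → b ≤ ⋁ L T → ¬ NBB L _≺_ (T ∪ ⁅ b ⁆)
      go T (acc smaller) T⊆I b∉T b≤⋁T nbb with Subsetₚ.nonempty? T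
      ... | no T≡∅ = proj₂ (proj₁ atb) (≤-antisym (minimum b) (subst (b ≤_) (⋁∅≡⊥ T≡∅) b≤⋁T))
      ... | yes T≢∅ with least sto T T≢∅
      ... | t , t∈T , t-least with ≺.compare t b
      ... | tri≈ _ refl _ = b∉T t∈T
      ... | tri> _ _ b≺t = nbb T (Subsetₚ.p⊆p∪q ⁅ b ⁆) (T≢∅ , (λ x → atI x ∘ T⊆I) , b , atb , b≺T , b≤⋁T)
        where
        b≺T : ∀ d → d ∈ T → b ≺ d
        b≺T d d∈T with d Finₚ.≟ t
        ... | yes refl = b≺t
        ... | no d≢t  = ≺.trans b≺t (t-least d∈T d≢t)
      ... | tri< t≺b _ _ with b ≤? ⋁ L (T - t)
      ...   | yes b≤⋁T-t = go (T - t) (smaller (Subsetₚ.x∈p⇒p-x⊂p t∈T)) (T⊆I ∘ p-y⊆p T t) (b∉T ∘ p-y⊆p T t)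
                             b≤⋁T-t (NBB-⊆ (T-t∪b⊆T∪b T t) nbb)
      ...   | no b≰⋁T-t = nbb ((T - t) ∪ ⁅ b ⁆) (T-t∪b⊆T∪b T t)
                            ( (b , y∈p∪⁅y⁆ (T - t) b)
                            , AtomSet-∪⁅⁆ (λ x → atI x ∘ T⊆I ∘ p-y⊆p T t) atb
                            , t , atI t (T⊆I t∈T) , t≺T-t∪b , exchange T⊆I t∈T b≤⋁T b≰⋁T-t )
        where
        t≺T-t∪b : ∀ d → d ∈ (T - t) ∪ ⁅ b ⁆ → t ≺ d
        t≺T-t∪b d d∈ = [ (λ d∈T-t → t-least (p-y⊆p T t d∈T-t) (x∈p-y⇒x≢y d∈T-t)) , (λ { refl → t≺b }) ]′
                         (x∈p∪⁅y⁆⁻ (T - t) d∈)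

  basis⇒⋁≡⊤ : Atomic L → ∀ {I} → Basis L I → ⋁ L I ≡ ⊤
  basis⇒⋁≡⊤ atomic {I} ((atI , _) , maximal , indI) with atomic ⊤
  ... | S , atS , ⋁S≡⊤ = ≤-antisym (maximum _) (subst (_≤ ⋁ L I) ⋁S≡⊤ (⋁-least S ≤⋁I))
    where
    ≤⋁I : ∀ {b} → b ∈ S → b ≤ ⋁ L I
    ≤⋁I {b} b∈S with b ≤? ⋁ L I
    ... | yes b≤⋁I = b≤⋁I
    ... | no b≰⋁I = contradiction (x≤⋁ I (maximal (I ∪ ⁅ b ⁆) InI-I∪b (Subsetₚ.p⊆p∪q ⁅ b ⁆) (y∈p∪⁅y⁆ I b))) b≰⋁I
      where
      InI-I∪b : InI L (I ∪ ⁅ b ⁆)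
      InI-I∪b = AtomSet-∪⁅⁆ atI (atS b b∈S) , extensionOrder I b , extension-NBB indI (inj₂ b≰⋁I)

  spanning-independent⇒basis : ∀ {I} → AtomSet L I → Independent I → ⋁ L I ≡ ⊤ → Basis L I
  spanning-independent⇒basis {I} atI indI ⋁I≡⊤ = independent⇒InI indI atI , maximal , indI
    where
    maximal : ∀ J → InI L J → I ⊆ J → J ⊆ I
    maximal J (atJ , ω , nbbJ) I⊆J {x} x∈J with x Subsetₚ.∈? I
    ... | yes x∈I = x∈I
    ... | no x∉I  = Empty.⊥-elim (dependent-extension-¬NBB indI atI (atJ x x∈J) ω I (λ x∈I → x∈I) x∉I
                      (subst (x ≤_) (sym ⋁I≡⊤) (maximum x)) (NBB-⊆ (p∪⁅y⁆⊆q I⊆J x∈J) nbbJ))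

module Hyperplanes (L : FinLattice) {r} (isRank : IsRank L r) {I : Subset (FinLattice.n L)}
                   (indI : Order.Independent L I) (⋁I≡⊤ : ⋁ L I ≡ FinLattice.⊤ L) where
  open FinLattice L
  open Order L
  open Rank L isRank
  open Order (dual L) using ()
    renaming (⋁-remove to ⋀-remove; ⋁∅≡⊥ to ⋀∅≡⊤; ∈oppSet⁻ to ∈oppSetᵒᵖ⁻; ∈oppSet⁺ to ∈oppSetᵒᵖ⁺)

  H : Fin n → Fin n
  H a = ⋁ L (I - a)

  rank⊤≡∣I∣ : r ⊤ ≡ ∣ I ∣
  rank⊤≡∣I∣ = trans (cong r (sym ⋁I≡⊤)) (rank-⋁ indI (λ a∈I → a∈I))

  H⋖⊤ : ∀ {a} → a ∈ I → _⋖_ L (H a) ⊤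
  H⋖⊤ a∈I = subst (_⋖_ L _) ⋁I≡⊤ (⋁-remove-⋖ indI (λ x∈I → x∈I) a∈I)

  a≰Ha : ∀ {a} → a ∈ I → ¬ a ≤ H a
  a≰Ha = ≰⋁-remove indI (λ x∈I → x∈I)

  a≤Hc : ∀ {a c} → a ∈ I → a ≢ c → a ≤ H c
  a≤Hc {c = c} a∈I a≢c = x≤⋁ (I - c) (Subsetₚ.x∈p∧x≢y⇒x∈p-y a∈I a≢c)

  H-injective : ∀ {a c} → a ∈ I → H a ≡ H c → a ≡ c
  H-injective {a} {c} a∈I Ha≡Hc = decidable-stable (a Finₚ.≟ c)
    λ a≢c → a≰Ha a∈I (subst (a ≤_) (sym Ha≡Hc) (a≤Hc a∈I a≢c))

  Hc∧⋁T≡⋁T-c : ∀ {T c} → T ⊆ I → c ∈ T → (H c ∧ ⋁ L T) ≡ ⋁ L (T - c)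
  Hc∧⋁T≡⋁T-c {T} {c} T⊆I c∈T
    with ⋖-squeeze (⋁-remove-⋖ indI T⊆I c∈T)
                   (∧-greatest (⋁-mono (p⊆q⇒p-y⊆q-y {y = c} T⊆I)) (⋁-mono (p-y⊆p T c))) (x∧y≤y _ _)
  ... | inj₁ ≡⋁T-c = ≡⋁T-c
  ... | inj₂ ≡⋁T   = contradiction (≤-trans (x≤⋁ T c∈T) (subst (_≤ H c) ≡⋁T (x∧y≤x _ _))) (a≰Ha (T⊆I c∈T))

  record HyperplaneMeet (K : Subset n) : Set where
    field
      support           : Subset n
      support⊆I         : support ⊆ I
      ⋀K≡⋁support       : ⋀ L K ≡ ⋁ L support
      ∣support∣+∣K∣≡∣I∣ : ∣ support ∣ + ∣ K ∣ ≡ ∣ I ∣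
      ∈support⇒H∉K      : ∀ {a} → a ∈ support → H a ∉ K
      H∉K⇒∈support      : ∀ {a} → a ∈ I → H a ∉ K → a ∈ support

  hyperplaneMeet : ∀ K → K ⊆ oppSet L I → HyperplaneMeet K
  hyperplaneMeet K = go K (⊂-wellFounded K)
    where
    go : ∀ K → Acc _⊂_ K → K ⊆ oppSet L I → HyperplaneMeet K
    go K (acc smaller) K⊆ with Subsetₚ.nonempty? K
    ... | no K≡∅ = record
      { support           = I
      ; support⊆I         = λ a∈I → a∈I
      ; ⋀K≡⋁support       = trans (⋀∅≡⊤ K≡∅) (sym ⋁I≡⊤)
      ; ∣support∣+∣K∣≡∣I∣ = trans (cong (∣ I ∣ +_) (∣p∣≡0 K≡∅)) (ℕₚ.+-identityʳ _)
      ; ∈support⇒H∉K      = λ _ Ha∈K → K≡∅ (_ , Ha∈K)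
      ; H∉K⇒∈support      = λ a∈I _ → a∈I
      }
    ... | yes (h , h∈K) with ∈oppSet⁻ {I} (K⊆ h∈K)
    ... | c , c∈I , refl = record
      { support           = T - c
      ; support⊆I         = T⊆I ∘ p-y⊆p T c
      ; ⋀K≡⋁support       = begin
          ⋀ L K                ≡⟨ ⋀-remove K h∈K ⟩
          (H c ∧ ⋀ L (K - H c)) ≡⟨ cong (H c ∧_) ⋀≡⋁T ⟩
          (H c ∧ ⋁ L T)         ≡⟨ Hc∧⋁T≡⋁T-c T⊆I c∈T ⟩
          ⋁ L (T - c)           ∎
      ; ∣support∣+∣K∣≡∣I∣ = begin
          ∣ T - c ∣ + ∣ K ∣             ≡⟨ cong (∣ T - c ∣ +_) (∣p∣≡1+∣p-x∣ K h∈K) ⟩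
          ∣ T - c ∣ + suc ∣ K - H c ∣   ≡⟨ ℕₚ.+-suc ∣ T - c ∣ ∣ K - H c ∣ ⟩
          suc ∣ T - c ∣ + ∣ K - H c ∣   ≡⟨ cong (_+ ∣ K - H c ∣) (∣p∣≡1+∣p-x∣ T c∈T) ⟨
          ∣ T ∣ + ∣ K - H c ∣           ≡⟨ ∣T∣+∣K-Hc∣≡∣I∣ ⟩
          ∣ I ∣                         ∎
      ; ∈support⇒H∉K      = ∈T-c⇒H∉K
      ; H∉K⇒∈support      = λ a∈I Ha∉K →
          Subsetₚ.x∈p∧x≢y⇒x∈p-y (H∉K⇒∈T a∈I (Ha∉K ∘ p-y⊆p K (H c))) (λ { refl → Ha∉K h∈K })
      }
      where
      open ≡-Reasoning
      open HyperplaneMeet (go (K - H c) (smaller (Subsetₚ.x∈p⇒p-x⊂p h∈K)) (K⊆ ∘ p-y⊆p K (H c)))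
        renaming (support to T; support⊆I to T⊆I; ⋀K≡⋁support to ⋀≡⋁T; ∣support∣+∣K∣≡∣I∣ to ∣T∣+∣K-Hc∣≡∣I∣;
                  ∈support⇒H∉K to ∈T⇒H∉K; H∉K⇒∈support to H∉K⇒∈T)

      c∈T : c ∈ T
      c∈T = H∉K⇒∈T c∈I (λ Hc∈K-Hc → x∈p-y⇒x≢y Hc∈K-Hc refl)

      ∈T-c⇒H∉K : ∀ {a} → a ∈ T - c → H a ∉ K
      ∈T-c⇒H∉K {a} a∈T-c Ha∈K with H a Finₚ.≟ H c
      ... | yes Ha≡Hc = x∈p-y⇒x≢y a∈T-c (H-injective (T⊆I (p-y⊆p T c a∈T-c)) Ha≡Hc)
      ... | no Ha≢Hc  = ∈T⇒H∉K (p-y⊆p T c a∈T-c) (Subsetₚ.x∈p∧x≢y⇒x∈p-y Ha∈K Ha≢Hc)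

  oppSet-atoms : AtomSet (dual L) (oppSet L I)
  oppSet-atoms y y∈ with ∈oppSet⁻ {I} y∈
  ... | a , a∈I , refl = ⋖-dual (H⋖⊤ a∈I)

  oppSet-independent : Order.Independent (dual L) (oppSet L I)
  oppSet-independent J J⊆ r′ isRank′ = ℕₚ.+-cancelʳ-≡ ∣ T ∣ _ _ (begin
    r′ (⋀ L J) + ∣ T ∣          ≡⟨ cong (r′ (⋀ L J) +_) (trans (cong r ⋀K≡⋁support) (rank-⋁ indI support⊆I)) ⟨
    r′ (⋀ L J) + r (⋀ L J)      ≡⟨ rank-dual-sum isRank′ (⋀ L J) ⟩
    r ⊤                         ≡⟨ rank⊤≡∣I∣ ⟩
    ∣ I ∣                       ≡⟨ ∣support∣+∣K∣≡∣I∣ ⟨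
    ∣ T ∣ + ∣ J ∣               ≡⟨ ℕₚ.+-comm ∣ T ∣ ∣ J ∣ ⟩
    ∣ J ∣ + ∣ T ∣               ∎)
    where
    open ≡-Reasoning
    open HyperplaneMeet (hyperplaneMeet J J⊆) renaming (support to T)

  ⋀oppSet≡⊥ : ⋁ (dual L) (oppSet L I) ≡ ⊥
  ⋀oppSet≡⊥ = trans ⋀K≡⋁support (⋁∅≡⊥ λ (a , a∈T) → ∈support⇒H∉K a∈T (∈oppSet⁺ (support⊆I a∈T)))
    where open HyperplaneMeet (hyperplaneMeet (oppSet L I) (λ y∈ → y∈))

  ⋀oppSet-Ha≡a : ∀ {a} → a ∈ I → ⋀ L (oppSet L I - H a) ≡ a
  ⋀oppSet-Ha≡a {a} a∈I = trans ⋀K≡⋁support (≤-antisym (⋁-least T (≤-reflexive ∘ ≡a)) (x≤⋁ T a∈T))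
    where
    open HyperplaneMeet (hyperplaneMeet (oppSet L I - H a) (p-y⊆p (oppSet L I) (H a)))
      renaming (support to T)

    a∈T : a ∈ T
    a∈T = H∉K⇒∈support a∈I (λ Ha∈ → x∈p-y⇒x≢y Ha∈ refl)

    ≡a : ∀ {t} → t ∈ T → t ≡ a
    ≡a {t} t∈T = H-injective (support⊆I t∈T) (decidable-stable (H t Finₚ.≟ H a) λ Ht≢Ha →
      ∈support⇒H∉K t∈T (Subsetₚ.x∈p∧x≢y⇒x∈p-y (∈oppSet⁺ (support⊆I t∈T)) Ht≢Ha))

  oppSet-involutive : oppSet (dual L) (oppSet L I) ≡ I
  oppSet-involutive = Subsetₚ.⊆-antisym ⊆I I⊆
    where
    ⊆I : oppSet (dual L) (oppSet L I) ⊆ I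
    ⊆I y∈ with ∈oppSetᵒᵖ⁻ {oppSet L I} y∈
    ... | h , h∈ , refl with ∈oppSet⁻ {I} h∈
    ... | a , a∈I , refl = subst (_∈ I) (sym (⋀oppSet-Ha≡a a∈I)) a∈I

    I⊆ : I ⊆ oppSet (dual L) (oppSet L I)
    I⊆ a∈I = subst (_∈ oppSet (dual L) (oppSet L I)) (⋀oppSet-Ha≡a a∈I) (∈oppSetᵒᵖ⁺ (∈oppSet⁺ a∈I))

dual-graded : (L : FinLattice) → Graded L → Graded (dual L)
dual-graded L (r , isRank) =
  (λ x → r ⊤ ∸ r x) , ℕₚ.n∸n≡0 (r ⊤) , (λ _ _ y≤x → ℕₚ.∸-monoʳ-≤ (r ⊤) (rank-mono y≤x)) , rank-suc
  where
  open FinLattice L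
  open Order L
  open Rank L isRank

  -- (1 + r ⊤) ∸ suc (r y) reduces to r ⊤ ∸ r y.
  rank-suc : ∀ x y → _⋖_ (dual L) x y → r ⊤ ∸ r y ≡ suc (r ⊤ ∸ r x)
  rank-suc x y x⋗y = trans (ℕₚ.+-∸-assoc 1 (subst (_≤ℕ r ⊤) rx≡1+ry (rank-mono (maximum x))))
                           (cong (λ k → suc (r ⊤ ∸ k)) (sym rx≡1+ry))
    where
    rx≡1+ry : r x ≡ suc (r y)
    rx≡1+ry = rank-⋖ (Order.⋖-dual (dual L) x⋗y)

dual-atomic : (L : FinLattice) → Coatomic L → Atomic (dual L)
dual-atomic L coatomic x =
  let S , coatoms , ⋀S≡x = coatomic x in S , (λ y y∈S → Order.⋖-dual L (coatoms y y∈S)) , ⋀S≡x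

module _ (L : FinLattice) (atomic : Atomic L) (graded : Graded L) where
  private
    module Hyperplanesᴵ {I} (basis : Basis L I) =
      Hyperplanes L (proj₂ graded) (proj₂ (proj₂ basis)) (Rank.basis⇒⋁≡⊤ L (proj₂ graded) atomic basis)

  oppSet-basis : ∀ {I} → Basis L I → Basis (dual L) (oppSet L I)
  oppSet-basis basis = Rank.spanning-independent⇒basis (dual L) (proj₂ (dual-graded L graded))
    oppSet-atoms oppSet-independent ⋀oppSet≡⊥
    where open Hyperplanesᴵ basis

  oppSet-oppSet : ∀ {I} → Basis L I → oppSet (dual L) (oppSet L I) ≡ I
  oppSet-oppSet basis = Hyperplanesᴵ.oppSet-involutive basis

  oppSet-injective : ∀ {I J} → Basis L I → Basis L J → oppSet L I ≡ oppSet L J → I ≡ J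
  oppSet-injective {I} {J} basisI basisJ oppI≡oppJ = begin
    I                            ≡⟨ oppSet-oppSet basisI ⟨
    oppSet (dual L) (oppSet L I) ≡⟨ cong (oppSet (dual L)) oppI≡oppJ ⟩
    oppSet (dual L) (oppSet L J) ≡⟨ oppSet-oppSet basisJ ⟩
    J                            ∎
    where open ≡-Reasoning

theorem4p5 : (L : FinLattice) → Atomic L → Graded L → Coatomic L →
    ((I : Subset (FinLattice.n L)) → Basis L I → Basis (dual L) (oppSet L I))
    × ((I J : Subset (FinLattice.n L)) → Basis L I → Basis L J →
         oppSet L I ≡ oppSet L J → I ≡ J)
    × ((K : Subset (FinLattice.n L)) → Basis (dual L) K →
         Σ[ I ∈ Subset (FinLattice.n L) ] (Basis L I × (oppSet L I ≡ K)))
theorem4p5 L atomic graded coatomic =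
    (λ _ → oppSet-basis L atomic graded)
  , (λ _ _ → oppSet-injective L atomic graded)
    -- the first two parts for dual L, using that dual (dual L) is definitionally L
  , λ K basisK → oppSet (dual L) K , oppSet-basis (dual L) atomicᵒᵖ gradedᵒᵖ basisK
                                   , oppSet-oppSet (dual L) atomicᵒᵖ gradedᵒᵖ basisK
  where
  atomicᵒᵖ : Atomic (dual L)
  atomicᵒᵖ = dual-atomic L coatomic

  gradedᵒᵖ : Graded (dual L)
  gradedᵒᵖ = dual-graded L graded
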